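{- Every formula $\phi$ of the form $F\wedge \forall \bar{x}\;.\; Q$ that has a satisfiability certificate is satisfiable.
   Context: Setting: $F$ and $Q$ are quantifier-free formulas. The quantified variables $\bar{x}=(x_1,\dots,x_n)$ (so $n$ is the number of quantified variables) have a sort $\mathbb{D}$. All uninterpreted function symbols have domain $\mathbb{D}$ and codomain $\mathbb{D}'$. Both $\mathbb{D}$ and $\mathbb{D}'$ have canonical models of the same name, with $\mathbb{D}$ countable. Every $z\in\mathbb{D}$ has an interpreted constant $\hat z$ denoting it. Arguments of uninterpreted function symbols contain no uninterpreted function symbols of non-zero arity. For $z\in\mathbb{D}^n$, $Q[\bar x\mapsto \hat z]$ denotes the result of substituting the constants $\hat z$ for $\bar x$ in $Q$. A cell is a term $f(n_1,\dots,n_k)$ with $f$ uninterpreted and $n_i\in\mathbb{D}$. A cell interpretation $I$ is a partial function from cells to $\mathbb{D}'$; $\mathit{def}(I)$ is its domain. An interpretation is compatible with $I$ if it agrees with $I$ where $I$ is defined. For a term $t$, $I(t)$ is the value of $t$ if it is the same in every compatible interpretation, else $\bot$. $I\models\psi$ means every compatible interpretation satisfies $\psi$. A pre-satisfiability certificate of $\phi$ is a cell interpretation $I$ with $I\models F$ and such that for every $z\in\mathbb{D}^n$, every uninterpreted $f$ and every argument term $t$ of $f$ in $Q$, $I(t[\bar x\mapsto\hat z])\neq\bot$. The relevant cells are $\Gamma_{I,z}(\phi)=\{f(I(t[\bar x\mapsto\hat z]))\mid t \text{ an argument term of } f \text{ in } Q,\ f \text{ uninterpreted}\}$. A satisfiability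 certificate for $\phi$ consists of: a pre-satisfiability certificate $I$ of $\phi$; a well-order $\preceq$ on $\mathbb{D}^n$; and for every $z\in\mathbb{D}^n$, a set $X_z\subseteq\Gamma_{I,z}(\phi)$ of propagated cells with $X_z\cap\mathit{def}(I)=\emptyset$ and $X_z\cap\bigcup_{z'\prec z}\Gamma_{I,z'}(\phi)=\emptyset$, together with a satisfiability propagator showing that for all values of the cells in $\Gamma_{I,z}(\phi)\setminus\mathit{def}(I)\setminus X_z$ there exist values for the cells in $X_z$ such that, for the cell interpretation $I_{X_z}$ assigning these values, $I\cup I_{X_z}\models Q[\bar x\mapsto\hat z]$. -}

module Defs where

open import Level using (0ℓ)
open import Data.Nat using (ℕ; zero; suc)
open import Data.Fin using (Fin)
open import Data.List using (List; []; _∷_)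
open import Data.List.Relation.Unary.All using (All)
open import Data.Vec using (Vec; lookup)
open import Data.Maybe using (Maybe; just; nothing)
open import Data.Product using (Σ; _×_; proj₁; proj₂; _,_)
open import Data.Sum using (_⊎_)
open import Data.Unit using (⊤)
open import Data.Empty using (⊥)
open import Relation.Nullary using (¬_)
open import Relation.Binary using (Rel; IsStrictTotalOrder)
open import Relation.Binary.PropositionalEquality using (_≡_)
open import Induction.WellFounded using (WellFounded)
open import Function.Definitions using (Injective)

record Setting : Set₁ where
  field
    Sort   : Set
    ⟦_⟧    : Sort → Set
    sD sD' : Sort
    countable : Σ (⟦ sD ⟧ → ℕ) (λ e → Injective _≡_ _≡_ e)
    d'₀ : ⟦ sD' ⟧
    IFun  : Set
    ifDom : IFun → List Sort
    ifCod : IFun → Sort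
    ifSem : (g : IFun) → All ⟦_⟧ (ifDom g) → ⟦ ifCod g ⟧
    IPred : Set
    ipDom : IPred → List Sort
    ipSem : (p : IPred) → All ⟦_⟧ (ipDom p) → Set
    UFun  : Set
    arity : UFun → ℕ

module _ (S : Setting) where
  open Setting S

  D : Set
  D = ⟦ sD ⟧

  D' : Set
  D' = ⟦ sD' ⟧

  data Term (n : ℕ) : Sort → Set
  data Terms (n : ℕ) : List Sort → Set
  data DTerms (n : ℕ) : ℕ → Set

  data Term n where
    var : Fin n → Term n sD
    cst : D → Term n sD
    op  : (g : IFun) → Terms n (ifDom g) → Term n (ifCod g)
    app : (f : UFun) → DTerms n (arity f) → Term n sD'

  data Terms n where
    []  : Terms n []
    _∷_ : ∀ {s ss} → Term n s → Terms n ss → Terms n (s ∷ ss)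

  data DTerms n where
    []  : DTerms n zero
    _∷_ : ∀ {k} → Term n sD → DTerms n k → DTerms n (suc k)

  data Formula (n : ℕ) : Set where
    true false : Formula n
    atom : (p : IPred) → Terms n (ipDom p) → Formula n
    eq   : ∀ {s} → Term n s → Term n s → Formula n
    neg  : Formula n → Formula n
    and or : Formula n → Formula n → Formula n

  lookupD : ∀ {n k} → DTerms n k → Fin k → Term n sD
  lookupD (t ∷ ts) Fin.zero    = t
  lookupD (t ∷ ts) (Fin.suc i) = lookupD ts i

  substT  : ∀ {n s}  → Vec D n → Term n s → Term 0 s
  substTs : ∀ {n ss} → Vec D n → Terms n ss → Terms 0 ss
  substD  : ∀ {n k}  → Vec D n → DTerms n k → DTerms 0 k
  substT z (var i)    = cst (lookup z i)
  substT z (cst d)    = cst d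
  substT z (op g ts)  = op g (substTs z ts)
  substT z (app f ts) = app f (substD z ts)
  substTs z []       = []
  substTs z (t ∷ ts) = substT z t ∷ substTs z ts
  substD z []       = []
  substD z (t ∷ ts) = substT z t ∷ substD z ts

  substF : ∀ {n} → Vec D n → Formula n → Formula 0
  substF z true       = true
  substF z false      = false
  substF z (atom p ts) = atom p (substTs z ts)
  substF z (eq t u)   = eq (substT z t) (substT z u)
  substF z (neg φ)    = neg (substF z φ)
  substF z (and φ ψ)  = and (substF z φ) (substF z ψ)
  substF z (or φ ψ)   = or (substF z φ) (substF z ψ)

  UInterp : Set
  UInterp = (f : UFun) → Vec D (arity f) → D'

  evalT  : ∀ {n s}  → UInterp → Vec D n → Term n s → ⟦ s ⟧
  evalTs : ∀ {n ss} → UInterp → Vec D n → Terms n ss → All ⟦_⟧ ss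
  evalD  : ∀ {n k}  → UInterp → Vec D n → DTerms n k → Vec D k
  evalT M ρ (var i)    = lookup ρ i
  evalT M ρ (cst d)    = d
  evalT M ρ (op g ts)  = ifSem g (evalTs M ρ ts)
  evalT M ρ (app f ts) = M f (evalD M ρ ts)
  evalTs M ρ []       = All.[]
  evalTs M ρ (t ∷ ts) = evalT M ρ t All.∷ evalTs M ρ ts
  evalD M ρ []       = Vec.[]
  evalD M ρ (t ∷ ts) = evalT M ρ t Vec.∷ evalD M ρ ts

  sat : ∀ {n} → UInterp → Vec D n → Formula n → Set
  sat M ρ true        = ⊤
  sat M ρ false       = ⊥
  sat M ρ (atom p ts) = ipSem p (evalTs M ρ ts)
  sat M ρ (eq t u)    = evalT M ρ t ≡ evalT M ρ u
  sat M ρ (neg φ)     = ¬ sat M ρ φ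
  sat M ρ (and φ ψ)   = sat M ρ φ × sat M ρ ψ
  sat M ρ (or φ ψ)    = sat M ρ φ ⊎ sat M ρ ψ

  Satisfiable : ∀ {n} → Formula 0 → Formula n → Set
  Satisfiable {n} F Q =
    Σ UInterp λ M → sat M Vec.[] F × ((ρ : Vec D n) → sat M ρ Q)

  data OccT  {n} : ∀ {s} → Term n s → (f : UFun) → DTerms n (arity f) → Set
  data OccTs {n} : ∀ {ss} → Terms n ss → (f : UFun) → DTerms n (arity f) → Set
  data OccD  {n} : ∀ {k} → DTerms n k → (f : UFun) → DTerms n (arity f) → Set

  data OccT {n} where
    here  : ∀ {f ts} → OccT (app f ts) f ts
    inOp  : ∀ {g us f ts} → OccTs us f ts → OccT (op g us) f ts
    inApp : ∀ {g us f ts} → OccD us f ts → OccT (app g us) f ts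

  data OccTs {n} where
    hd : ∀ {s ss} {t : Term n s} {us : Terms n ss} {f ts} → OccT t f ts → OccTs (t ∷ us) f ts
    tl : ∀ {s ss} {t : Term n s} {us : Terms n ss} {f ts} → OccTs us f ts → OccTs (t ∷ us) f ts

  data OccD {n} where
    hd : ∀ {k} {t : Term n sD} {us : DTerms n k} {f ts} → OccT t f ts → OccD (t ∷ us) f ts
    tl : ∀ {k} {t : Term n sD} {us : DTerms n k} {f ts} → OccD us f ts → OccD (t ∷ us) f ts

  data OccF {n} : Formula n → (f : UFun) → DTerms n (arity f) → Set where
    inAtom : ∀ {p us f ts} → OccTs us f ts → OccF (atom p us) f ts
    inEqˡ  : ∀ {s} {t u : Term n s} {f ts} → OccT t f ts → OccF (eq t u) f ts
    inEqʳ  : ∀ {s} {t u : Term n s} {f ts} → OccT u f ts → OccF (eq t u) f ts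
    inNeg  : ∀ {φ f ts} → OccF φ f ts → OccF (neg φ) f ts
    inAndˡ : ∀ {φ ψ f ts} → OccF φ f ts → OccF (and φ ψ) f ts
    inAndʳ : ∀ {φ ψ f ts} → OccF ψ f ts → OccF (and φ ψ) f ts
    inOrˡ  : ∀ {φ ψ f ts} → OccF φ f ts → OccF (or φ ψ) f ts
    inOrʳ  : ∀ {φ ψ f ts} → OccF ψ f ts → OccF (or φ ψ) f ts

  NoUFArgs : ∀ {n} → Formula n → Set
  NoUFArgs {n} φ = ∀ f (ts : DTerms n (arity f)) → OccF φ f ts →
    ∀ g (us : DTerms n (arity g)) → OccD ts g us → arity g ≡ 0

  Cell : Set
  Cell = Σ UFun (λ f → Vec D (arity f))

  CellInterp : Set
  CellInterp = Cell → Maybe D'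

  cellVal : UInterp → Cell → D'
  cellVal M c = M (proj₁ c) (proj₂ c)

  Compatible : UInterp → CellInterp → Set
  Compatible M I = ∀ c v → I c ≡ just v → cellVal M c ≡ v

  _⊨_ : CellInterp → Formula 0 → Set
  I ⊨ ψ = ∀ M → Compatible M I → sat M Vec.[] ψ

  HasValue : ∀ {s} → CellInterp → Term 0 s → ⟦ s ⟧ → Set
  HasValue I t v = ∀ M → Compatible M I → evalT M Vec.[] t ≡ v

  HasValueD : ∀ {k} → CellInterp → DTerms 0 k → Vec D k → Set
  HasValueD I ts vs = ∀ M → Compatible M I → evalD M Vec.[] ts ≡ vs

  Defined : ∀ {s} → CellInterp → Term 0 s → Set
  Defined {s} I t = Σ ⟦ s ⟧ (HasValue I t)

  PreCertificate : ∀ {n} → CellInterp → Formula 0 → Formula n → Set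
  PreCertificate {n} I F Q =
    (I ⊨ F) ×
    ((z : Vec D n) (f : UFun) (ts : DTerms n (arity f)) → OccF Q f ts →
       (i : Fin (arity f)) → Defined I (substT z (lookupD ts i)))

  InΓ : ∀ {n} → CellInterp → Formula n → Vec D n → Cell → Set
  InΓ {n} I Q z c =
    Σ (DTerms n (arity (proj₁ c))) λ ts →
      OccF Q (proj₁ c) ts × HasValueD I (substD z ts) (proj₂ c)

  record SatCertificate {n : ℕ} (F : Formula 0) (Q : Formula n) : Set₁ where
    field
      I      : CellInterp
      pre    : PreCertificate I F Q
      _≺_    : Rel (Vec D n) 0ℓ
      isSTO  : IsStrictTotalOrder _≡_ _≺_
      wf     : WellFounded _≺_
      X      : Vec D n → Cell → Set
      X⊆Γ    : ∀ z c → X z c → InΓ I Q z c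
      X-undef : ∀ z c → X z c → I c ≡ nothing
      X-fresh : ∀ z z' c → z' ≺ z → X z c → ¬ InΓ I Q z' c
      propagator : ∀ z (β : Cell → D') → Σ (Cell → D') λ γ →
        ∀ M → Compatible M I →
          (∀ c → InΓ I Q z c → I c ≡ nothing → ¬ X z c → cellVal M c ≡ β c) →
          (∀ c → X z c → cellVal M c ≡ γ c) →
          sat M Vec.[] (substF z Q)

{-# OPTIONS --safe #-}
module Submission where

open import Defs
open import Level using (0ℓ)
open import Data.Nat using (ℕ)
open import Axiom.ExcludedMiddle using (ExcludedMiddle)
open import Data.List using (List; []; _∷_; [_]; _++_; map; concatMap)
open import Data.List.Properties using (map-cong)
open import Data.List.Relation.Unary.Any using (here; there; tail)
open import Data.List.Membership.Propositional using (_∈_; lose)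
open import Data.List.Membership.Propositional.Properties using (∈-++⁺ˡ; ∈-++⁺ʳ; ∈-concatMap⁺)
import Data.List.Relation.Unary.All as All
open import Data.Vec as Vec using (Vec)
open import Data.Maybe using (nothing; fromMaybe)
open import Data.Product using (Σ; _×_; proj₁; proj₂; _,_)
open import Data.Sum using (inj₁; inj₂)
open import Data.Empty using (⊥-elim)
open import Relation.Nullary using (¬_; yes; no)
open import Relation.Unary using (_⊆′_)
open import Relation.Binary using (tri<; tri≈; tri>; IsStrictTotalOrder)
open import Relation.Binary.Definitions using (DecidableEquality)
open import Relation.Binary.PropositionalEquality
  using (_≡_; refl; sym; trans; cong; cong₂; cong-app; subst; module ≡-Reasoning)
open import Induction.WellFounded using (WfRec; module FixPoint)
import Induction.WellFounded as WF

-- The model is built stage by stage along the well-order on 𝔻ⁿ: the propagator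
-- at z receives the values of the relevant cells fixed by earlier stages and
-- chooses the cells of X_z.  Freshness makes each cell propagated at most once,
-- and guarantees that a relevant cell of z that is not in X_z was either
-- propagated at an earlier stage or never, so the final model agrees with what
-- every stage was promised, and each instance Q[x̄ ↦ ẑ] holds.

module _ {A B : Set} (_≟_ : DecidableEquality A) (default : B) where

  lookupIn : List A → List B → A → B
  lookupIn (k ∷ ks) (v ∷ vs) a with a ≟ k
  ... | yes _ = v
  ... | no _  = lookupIn ks vs a
  lookupIn _ _ _ = default

  lookupIn-map : ∀ (h : A → B) {a} ks → a ∈ ks → lookupIn ks (map h ks) a ≡ h a
  lookupIn-map h {a} (k ∷ ks) a∈ with a ≟ k
  ... | yes refl = refl
  ... | no a≢k   = lookupIn-map h ks (tail a≢k a∈)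

module Substitution (S : Setting) (M : UInterp S) where
  open Setting S

  evalT-substT : ∀ {n s} (z : Vec (D S) n) (t : Term S n s) →
                 evalT S M Vec.[] (substT S z t) ≡ evalT S M z t
  evalTs-substTs : ∀ {n ss} (z : Vec (D S) n) (ts : Terms S n ss) →
                   evalTs S M Vec.[] (substTs S z ts) ≡ evalTs S M z ts
  evalD-substD : ∀ {n k} (z : Vec (D S) n) (ts : DTerms S n k) →
                 evalD S M Vec.[] (substD S z ts) ≡ evalD S M z ts
  evalT-substT z (var i)    = refl
  evalT-substT z (cst d)    = refl
  evalT-substT z (op g ts)  = cong (ifSem g) (evalTs-substTs z ts)
  evalT-substT z (app f ts) = cong (M f) (evalD-substD z ts)
  evalTs-substTs z []       = refl
  evalTs-substTs z (t ∷ ts) = cong₂ All._∷_ (evalT-substT z t) (evalTs-substTs z ts)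
  evalD-substD z []       = refl
  evalD-substD z (t ∷ ts) = cong₂ Vec._∷_ (evalT-substT z t) (evalD-substD z ts)

  sat-substF⁻ : ∀ {n} (z : Vec (D S) n) φ → sat S M Vec.[] (substF S z φ) → sat S M z φ
  sat-substF⁺ : ∀ {n} (z : Vec (D S) n) φ → sat S M z φ → sat S M Vec.[] (substF S z φ)
  sat-substF⁻ z true        s = s
  sat-substF⁻ z false       s = s
  sat-substF⁻ z (atom p ts) s = subst (ipSem p) (evalTs-substTs z ts) s
  sat-substF⁻ z (eq t u)    s = trans (sym (evalT-substT z t)) (trans s (evalT-substT z u))
  sat-substF⁻ z (neg φ)     s = λ h → s (sat-substF⁺ z φ h)
  sat-substF⁻ z (and φ ψ) (s , s′) = sat-substF⁻ z φ s , sat-substF⁻ z ψ s′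
  sat-substF⁻ z (or φ ψ) (inj₁ s) = inj₁ (sat-substF⁻ z φ s)
  sat-substF⁻ z (or φ ψ) (inj₂ s) = inj₂ (sat-substF⁻ z ψ s)
  sat-substF⁺ z true        s = s
  sat-substF⁺ z false       s = s
  sat-substF⁺ z (atom p ts) s = subst (ipSem p) (sym (evalTs-substTs z ts)) s
  sat-substF⁺ z (eq t u)    s = trans (evalT-substT z t) (trans s (sym (evalT-substT z u)))
  sat-substF⁺ z (neg φ)     s = λ h → s (sat-substF⁻ z φ h)
  sat-substF⁺ z (and φ ψ) (s , s′) = sat-substF⁺ z φ s , sat-substF⁺ z ψ s′
  sat-substF⁺ z (or φ ψ) (inj₁ s) = inj₁ (sat-substF⁺ z φ s)
  sat-substF⁺ z (or φ ψ) (inj₂ s) = inj₂ (sat-substF⁺ z ψ s)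

module Occurrences (S : Setting) where
  open Setting S

  Occurrence : ℕ → Set
  Occurrence n = Σ UFun (λ f → DTerms S n (arity f))

  occsT : ∀ {n s} → Term S n s → List (Occurrence n)
  occsTs : ∀ {n ss} → Terms S n ss → List (Occurrence n)
  occsD : ∀ {n k} → DTerms S n k → List (Occurrence n)
  occsT (var i)    = []
  occsT (cst d)    = []
  occsT (op g ts)  = occsTs ts
  occsT (app f ts) = (f , ts) ∷ occsD ts
  occsTs []       = []
  occsTs (t ∷ ts) = occsT t ++ occsTs ts
  occsD []       = []
  occsD (t ∷ ts) = occsT t ++ occsD ts

  occsF : ∀ {n} → Formula S n → List (Occurrence n)
  occsF true        = []
  occsF false       = []
  occsF (atom p ts) = occsTs ts
  occsF (eq t u)    = occsT t ++ occsT u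
  occsF (neg φ)     = occsF φ
  occsF (and φ ψ)   = occsF φ ++ occsF ψ
  occsF (or φ ψ)    = occsF φ ++ occsF ψ

  occsT-complete : ∀ {n s} {t : Term S n s} {f ts} → OccT S t f ts → (f , ts) ∈ occsT t
  occsTs-complete : ∀ {n ss} {us : Terms S n ss} {f ts} → OccTs S us f ts → (f , ts) ∈ occsTs us
  occsD-complete : ∀ {n k} {us : DTerms S n k} {f ts} → OccD S us f ts → (f , ts) ∈ occsD us
  occsT-complete here      = here refl
  occsT-complete (inOp o)  = occsTs-complete o
  occsT-complete (inApp o) = there (occsD-complete o)
  occsTs-complete (hd o)         = ∈-++⁺ˡ (occsT-complete o)
  occsTs-complete (tl {t = t} o) = ∈-++⁺ʳ (occsT t) (occsTs-complete o)
  occsD-complete (hd o)         = ∈-++⁺ˡ (occsT-complete o)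
  occsD-complete (tl {t = t} o) = ∈-++⁺ʳ (occsT t) (occsD-complete o)

  occsF-complete : ∀ {n} {φ : Formula S n} {f ts} → OccF S φ f ts → (f , ts) ∈ occsF φ
  occsF-complete (inAtom o)             = occsTs-complete o
  occsF-complete (inEqˡ o)              = ∈-++⁺ˡ (occsT-complete o)
  occsF-complete (inEqʳ {t = t} o)      = ∈-++⁺ʳ (occsT t) (occsT-complete o)
  occsF-complete (inNeg o)              = occsF-complete o
  occsF-complete (inAndˡ o)             = ∈-++⁺ˡ (occsF-complete o)
  occsF-complete (inAndʳ {φ = φ} o)     = ∈-++⁺ʳ (occsF φ) (occsF-complete o)
  occsF-complete (inOrˡ o)              = ∈-++⁺ˡ (occsF-complete o)
  occsF-complete (inOrʳ {φ = φ} o)      = ∈-++⁺ʳ (occsF φ) (occsF-complete o)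

module Completion (S : Setting) where
  open Setting S

  completeWith : CellInterp S → (Cell S → D' S) → UInterp S
  completeWith I h f vs = fromMaybe (h (f , vs)) (I (f , vs))

  completeWith-compatible : ∀ I h → Compatible S (completeWith I h) I
  completeWith-compatible I h (f , vs) v Ic≡v rewrite Ic≡v = refl

  completeWith-undefined : ∀ I h c → I c ≡ nothing → cellVal S (completeWith I h) c ≡ h c
  completeWith-undefined I h (f , vs) Ic≡nothing rewrite Ic≡nothing = refl

  HasValueD-unique : ∀ {I k} {ts : DTerms S 0 k} {vs vs′} →
                     HasValueD S I ts vs → HasValueD S I ts vs′ → vs ≡ vs′
  HasValueD-unique {I} p q = trans (sym (p M₀ M₀-compatible)) (q M₀ M₀-compatible)
    where
    M₀ : UInterp S
    M₀ = completeWith I (λ _ → d'₀)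

    M₀-compatible : Compatible S M₀ I
    M₀-compatible = completeWith-compatible I (λ _ → d'₀)

module StagedModel (em : ExcludedMiddle 0ℓ) {S : Setting} {n : ℕ} {F : Formula S 0} {Q : Formula S n}
             (cert : SatCertificate S F Q) where
  open Setting S
  open Occurrences S
  open Completion S
  open SatCertificate cert

  Point : Set
  Point = Vec (D S) n

  cellsAt : Point → Occurrence n → List (Cell S)
  cellsAt z (f , ts) with em {Σ (Vec (D S) (arity f)) (HasValueD S I (substD S z ts))}
  ... | yes (vs , _) = [ f , vs ]
  ... | no _         = []

  relevantCells : Point → List (Cell S)
  relevantCells z = concatMap (cellsAt z) (occsF Q)

  InΓ⇒∈relevantCells : ∀ {z c} → InΓ S I Q z c → c ∈ relevantCells z
  InΓ⇒∈relevantCells {z} {f , vs} (ts , occ , hv) =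
    ∈-concatMap⁺ (cellsAt z) (lose (occsF-complete occ) ∈cellsAt)
    where
    ∈cellsAt : (f , vs) ∈ cellsAt z (f , ts)
    ∈cellsAt with em {Σ (Vec (D S) (arity f)) (HasValueD S I (substD S z ts))}
    ... | yes (vs′ , hv′) = here (cong (f ,_) (HasValueD-unique hv hv′))
    ... | no ∄vs          = ⊥-elim (∄vs (vs , hv))

  X-unique : ∀ {z z′ c} → X z c → X z′ c → z ≡ z′
  X-unique {z} {z′} {c} x x′ with IsStrictTotalOrder.compare isSTO z z′
  ... | tri< z≺z′ _ _ = ⊥-elim (X-fresh z′ z c z≺z′ x′ (X⊆Γ z c x))
  ... | tri≈ _ z≡z′ _ = z≡z′
  ... | tri> _ _ z′≺z = ⊥-elim (X-fresh z z′ c z′≺z x (X⊆Γ z′ c x′))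

  propagated-before : ∀ {z z′ c} → InΓ S I Q z c → ¬ X z c → X z′ c → z′ ≺ z
  propagated-before {z} {z′} {c} c∈Γ ¬x x′ with IsStrictTotalOrder.compare isSTO z′ z
  ... | tri< z′≺z _ _ = z′≺z
  ... | tri≈ _ refl _ = ⊥-elim (¬x x′)
  ... | tri> _ _ z≺z′ = ⊥-elim (X-fresh z′ z c z≺z′ x′ c∈Γ)

  PropagatedBefore : Point → Cell S → Set
  PropagatedBefore z c = Σ Point λ z′ → z′ ≺ z × X z′ c

  Propagated : Cell S → Set
  Propagated c = Σ Point λ z → X z c

  Assignment : Point → Set
  Assignment _ = Cell S → D' S

  earlier : ∀ z → WfRec _≺_ Assignment z → Cell S → D' S
  earlier z γ< c with em {PropagatedBefore z c}
  ... | yes (z′ , z′≺z , _) = γ< z′≺z c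
  ... | no _                = d'₀

  tableAt : Point → List (D' S) → Cell S → D' S
  tableAt z = lookupIn (λ _ _ → em) d'₀ (relevantCells z)

  -- The propagator's input is passed as a finite table rather than as the
  -- function earlier z γ<, so that the step respects pointwise equal
  -- recursive calls without function extensionality.
  input : ∀ z → WfRec _≺_ Assignment z → Cell S → D' S
  input z γ< = tableAt z (map (earlier z γ<) (relevantCells z))

  step : WfRec _≺_ Assignment ⊆′ Assignment
  step z γ< = proj₁ (propagator z (input z γ<))

  step-cong : ∀ z {γ< γ<′ : WfRec _≺_ Assignment z} →
              (∀ {z′} (z′≺z : z′ ≺ z) → γ< z′≺z ≡ γ<′ z′≺z) → step z γ< ≡ step z γ<′
  step-cong z {γ<} {γ<′} γ<≡γ<′ =
    cong (λ vs → proj₁ (propagator z (tableAt z vs))) (map-cong earlier-cong (relevantCells z))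
    where
    earlier-cong : ∀ c → earlier z γ< c ≡ earlier z γ<′ c
    earlier-cong c with em {PropagatedBefore z c}
    ... | yes (z′ , z′≺z , _) = cong-app (γ<≡γ<′ z′≺z) c
    ... | no _                = refl

  open FixPoint wf Assignment step step-cong using (unfold-wfRec)

  propagated : ∀ z → Assignment z
  propagated = WF.All.wfRec wf 0ℓ Assignment step

  propagatedValue : Cell S → D' S
  propagatedValue c with em {Propagated c}
  ... | yes (z , _) = propagated z c
  ... | no _        = d'₀

  propagatedValue-X : ∀ {z c} → X z c → propagatedValue c ≡ propagated z c
  propagatedValue-X {z} {c} x with em {Propagated c}
  ... | yes (z′ , x′) = cong (λ w → propagated w c) (X-unique x′ x)
  ... | no ∄z         = ⊥-elim (∄z (z , x))

  propagatedValue-earlier : ∀ {z c} → InΓ S I Q z c → ¬ X z c →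
                            propagatedValue c ≡ earlier z (λ _ → propagated _) c
  propagatedValue-earlier {z} {c} c∈Γ ¬x with em {Propagated c} | em {PropagatedBefore z c}
  ... | yes (z′ , x′) | yes (z″ , _ , x″) = cong (λ w → propagated w c) (X-unique x′ x″)
  ... | yes (z′ , x′) | no ∄z′            = ⊥-elim (∄z′ (z′ , propagated-before c∈Γ ¬x x′ , x′))
  ... | no ∄z         | yes (z″ , _ , x″) = ⊥-elim (∄z (z″ , x″))
  ... | no _          | no _              = refl

  model : UInterp S
  model = completeWith I propagatedValue

  model-compatible : Compatible S model I
  model-compatible = completeWith-compatible I propagatedValue

  model-instance : ∀ z → sat S model Vec.[] (substF S z Q)
  model-instance z = proj₂ (propagator z β) model model-compatible agrees-β agrees-γ
    where
    open ≡-Reasoning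

    β : Cell S → D' S
    β = input z (λ _ → propagated _)

    agrees-β : ∀ c → InΓ S I Q z c → I c ≡ nothing → ¬ X z c → cellVal S model c ≡ β c
    agrees-β c c∈Γ undefined ¬x = begin
      cellVal S model c                 ≡⟨ completeWith-undefined I propagatedValue c undefined ⟩
      propagatedValue c                 ≡⟨ propagatedValue-earlier c∈Γ ¬x ⟩
      earlier z (λ _ → propagated _) c  ≡⟨ lookupIn-map (λ _ _ → em) d'₀ _ _ (InΓ⇒∈relevantCells c∈Γ) ⟨
      β c                               ∎

    agrees-γ : ∀ c → X z c → cellVal S model c ≡ proj₁ (propagator z β) c
    agrees-γ c x = begin
      cellVal S model c              ≡⟨ completeWith-undefined I propagatedValue c (X-undef z c x) ⟩
      propagatedValue c              ≡⟨ propagatedValue-X x ⟩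
      propagated z c                 ≡⟨ cong-app unfold-wfRec c ⟩
      step z (λ _ → propagated _) c  ∎

theorem1 : ExcludedMiddle 0ℓ → (S : Setting) → (n : ℕ) → (F : Formula S 0) → (Q : Formula S n)
    → NoUFArgs S F → NoUFArgs S Q → SatCertificate S F Q → Satisfiable S F Q
theorem1 em S n F Q _ _ cert =
  model , proj₁ pre model model-compatible , λ z → sat-substF⁻ z Q (model-instance z)
  where
  open StagedModel em cert
  open Substitution S model using (sat-substF⁻)
  open SatCertificate cert using (pre)
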